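{- For each $X\in[\omega]^{<\omega}$, the map $h_X$ is the unique automorphism of $\mathcal{H}$ sending $\emptyset$ to $X$.
   Context: $\mathcal{H}=(H,\{D_i\}_{i<\omega},\{E_i\}_{i<\omega})$ has universe $H=[\omega]^{<\omega}\cup(\omega\times\{0,1\})$, where $[\omega]^{<\omega}$ is the set of finite subsets of $\omega$ (identified with characteristic functions, $X(i)\in\{0,1\}$). $E_i(X,Y)$ holds iff $X,Y\in[\omega]^{<\omega}$ and $X\triangle Y=\{i\}$. $D_i(X,(i,a))$ holds iff $X\in[\omega]^{<\omega}$ and $X(i)=a$; no other instances of these relations hold. For $X\in[\omega]^{<\omega}$, $h_X:H\to H$ is given by $h_X(Y)=X\triangle Y$ for $Y\in[\omega]^{<\omega}$ and $h_X(i,a)=(i,a+X(i)\bmod 2)$. -}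

module Defs where

open import Data.Nat using (ℕ; zero; suc)
open import Data.Bool using (Bool; true; false; _xor_)
open import Data.List using (List; []; _∷_; replicate; _++_)
open import Data.Unit using (⊤; tt)
open import Data.Empty using (⊥)
open import Data.Product using (_×_; _,_)
open import Data.Sum using (_⊎_; inj₁; inj₂)
open import Relation.Binary.PropositionalEquality using (_≡_)
open import Function.Bundles using (_⇔_)
open import Function.Definitions using (Bijective)

-- Finite subsets of ω, represented canonically as characteristic
-- bit-lists (bit i = X(i)) with no trailing 'false'.  Canonicity makes
-- propositional equality coincide with equality of sets.

Normal : List Bool → Set
Normal []            = ⊤
Normal (b ∷ [])      = b ≡ true
Normal (b ∷ c ∷ l)   = Normal (c ∷ l)

record FinSet : Set where
  constructor ⟨_,_⟩
  field
    bits   : List Bool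
    normal : Normal bits
open FinSet public

∅ : FinSet
∅ = ⟨ [] , tt ⟩

lookupD : List Bool → ℕ → Bool
lookupD []      _       = false
lookupD (b ∷ l) zero    = b
lookupD (b ∷ l) (suc i) = lookupD l i

_⟨_⟩ : FinSet → ℕ → Bool
X ⟨ i ⟩ = lookupD (bits X) i

cons : Bool → FinSet → FinSet
cons false ⟨ [] , _ ⟩     = ⟨ [] , tt ⟩
cons true  ⟨ [] , _ ⟩     = ⟨ true ∷ [] , _≡_.refl ⟩
cons b     ⟨ c ∷ l , p ⟩  = ⟨ b ∷ c ∷ l , p ⟩

norm : List Bool → FinSet
norm []      = ∅
norm (b ∷ l) = cons b (norm l)

xorL : List Bool → List Bool → List Bool
xorL []      m       = m
xorL (b ∷ l) []      = b ∷ l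
xorL (b ∷ l) (c ∷ m) = (b xor c) ∷ xorL l m

_△_ : FinSet → FinSet → FinSet
X △ Y = norm (xorL (bits X) (bits Y))

⟦_⟧ : ℕ → FinSet
⟦ i ⟧ = norm (replicate i false ++ (true ∷ []))

H : Set
H = FinSet ⊎ (ℕ × Bool)


E : ℕ → H → H → Set
E i (inj₁ X) (inj₁ Y) = X △ Y ≡ ⟦ i ⟧
E i _        _        = ⊥

D : ℕ → H → H → Set
D i (inj₁ X) (inj₂ (j , a)) = (j ≡ i) × (X ⟨ i ⟩ ≡ a)
D i _        _              = ⊥

IsAutomorphism : (H → H) → Set
IsAutomorphism f =
  Bijective _≡_ _≡_ f
  × (∀ i x y → E i x y ⇔ E i (f x) (f y))
  × (∀ i x y → D i x y ⇔ D i (f x) (f y))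

h : FinSet → H → H
h X (inj₁ Y)       = inj₁ (X △ Y)
h X (inj₂ (i , a)) = inj₂ (i , (a xor (X ⟨ i ⟩)))

-- h_X is an involution, and X cancels from (X △ Y) △ (X △ Z) and from the
-- D_i-condition, so h_X preserves, hence reflects, every E_i and D_i.
-- Conversely an automorphism g maps D_i-edges to D_i-edges, and a D_i-edge
-- starting at a set W ends at (i , W(i)); only the D_i are needed.  With W = ∅
-- this gives g (i , 0) = (i , X(i)), injectivity forces g (i , 1) = (i , 1 - X(i)),
-- and the edge from Y to (i , Y(i)) then shows that g Y has i-th bit X(i) + Y(i).
module Submission where

open import Defs
open import Data.Product using (_×_)
open import Data.Sum using (inj₁)
open import Relation.Binary.PropositionalEquality using (_≡_)

open import Data.Nat using (zero; suc)
open import Data.Bool using (true; false; _xor_)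
open import Data.Bool.Properties
  using (_≟_; xor-comm; xor-assoc; xor-same; xor-identityʳ; xor-annihilates-not;
         not-involutive; ¬-not)
open import Data.List using ([]; _∷_; replicate; _++_)
open import Data.Unit using (tt)
open import Data.Empty using (⊥)
open import Data.Product using (∃; _,_; proj₁; proj₂)
open import Data.Sum using (inj₂)
open import Data.Sum.Properties using (inj₂-injective)
open import Relation.Binary.Core using (Rel)
open import Relation.Binary.PropositionalEquality
  using (refl; sym; trans; cong; cong₂; subst; subst₂; module ≡-Reasoning)
open import Function.Bundles using (_⇔_; mk⇔; Equivalence)
open import Function.Definitions using (Bijective)
open import Function.Consequences.Propositional
  using (inverseᵇ⇒bijective; strictlyInverseˡ⇒inverseˡ; strictlyInverseʳ⇒inverseʳ)
open import Axiom.UniquenessOfIdentityProofs using (module Decidable⇒UIP)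

open ≡-Reasoning

xor-cancelˡ : ∀ x y → x xor (x xor y) ≡ y
xor-cancelˡ false y = refl
xor-cancelˡ true  y = not-involutive y

xor-cancelʳ : ∀ x y → (x xor y) xor y ≡ x
xor-cancelʳ x y = begin
  (x xor y) xor y  ≡⟨ xor-assoc x y y ⟩
  x xor (y xor y)  ≡⟨ cong (x xor_) (xor-same y) ⟩
  x xor false      ≡⟨ xor-identityʳ x ⟩
  x                ∎

xor-xor-cancelˡ : ∀ x y z → (x xor y) xor (x xor z) ≡ y xor z
xor-xor-cancelˡ false y z = refl
xor-xor-cancelˡ true  y z = xor-annihilates-not y z

lookupD-xorL : ∀ l m i → lookupD (xorL l m) i ≡ lookupD l i xor lookupD m i
lookupD-xorL []      m       i       = refl
lookupD-xorL (b ∷ l) []      i       = sym (xor-identityʳ _)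
lookupD-xorL (b ∷ l) (c ∷ m) zero    = refl
lookupD-xorL (b ∷ l) (c ∷ m) (suc i) = lookupD-xorL l m i

cons-⟨⟩ : ∀ b S i → cons b S ⟨ i ⟩ ≡ lookupD (b ∷ bits S) i
cons-⟨⟩ false ⟨ []    , _ ⟩ zero    = refl
cons-⟨⟩ false ⟨ []    , _ ⟩ (suc i) = refl
cons-⟨⟩ true  ⟨ []    , _ ⟩ i       = refl
cons-⟨⟩ false ⟨ c ∷ l , _ ⟩ i       = refl
cons-⟨⟩ true  ⟨ c ∷ l , _ ⟩ i       = refl

norm-⟨⟩ : ∀ l i → norm l ⟨ i ⟩ ≡ lookupD l i
norm-⟨⟩ []      i       = refl
norm-⟨⟩ (b ∷ l) zero    = cons-⟨⟩ b (norm l) zero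
norm-⟨⟩ (b ∷ l) (suc i) = trans (cons-⟨⟩ b (norm l) (suc i)) (norm-⟨⟩ l i)

△-⟨⟩ : ∀ X Y i → (X △ Y) ⟨ i ⟩ ≡ X ⟨ i ⟩ xor Y ⟨ i ⟩
△-⟨⟩ X Y i = trans (norm-⟨⟩ (xorL (bits X) (bits Y)) i) (lookupD-xorL (bits X) (bits Y) i)

⟦⟧-⟨⟩ : ∀ i → ⟦ i ⟧ ⟨ i ⟩ ≡ true
⟦⟧-⟨⟩ i = trans (norm-⟨⟩ (replicate i false ++ true ∷ []) i) (lookupD-replicate i)
  where
  lookupD-replicate : ∀ i → lookupD (replicate i false ++ true ∷ []) i ≡ true
  lookupD-replicate zero    = refl
  lookupD-replicate (suc i) = lookupD-replicate i

Normal-irrelevant : ∀ l (p q : Normal l) → p ≡ q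
Normal-irrelevant []          tt tt = refl
Normal-irrelevant (b ∷ [])    p  q  = Decidable⇒UIP.≡-irrelevant _≟_ p q
Normal-irrelevant (b ∷ c ∷ l) p  q  = Normal-irrelevant (c ∷ l) p q

Normal-tail : ∀ b l → Normal (b ∷ l) → Normal l
Normal-tail b []      _ = tt
Normal-tail b (c ∷ l) p = p

Normal⇒∃true : ∀ b l → Normal (b ∷ l) → ∃ λ i → lookupD (b ∷ l) i ≡ true
Normal⇒∃true b []      p = zero , p
Normal⇒∃true b (c ∷ l) p with i , q ← Normal⇒∃true c l p = suc i , q

normal-lookupD-injective : ∀ l m → Normal l → Normal m →
                           (∀ i → lookupD l i ≡ lookupD m i) → l ≡ m
normal-lookupD-injective []      []      _ _ _ = refl
normal-lookupD-injective []      (c ∷ m) _ q e with i , t ← Normal⇒∃true c m q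
  with () ← trans (e i) t
normal-lookupD-injective (b ∷ l) []      p _ e with i , t ← Normal⇒∃true b l p
  with () ← trans (sym (e i)) t
normal-lookupD-injective (b ∷ l) (c ∷ m) p q e =
  cong₂ _∷_ (e zero)
    (normal-lookupD-injective l m (Normal-tail b l p) (Normal-tail c m q) (λ i → e (suc i)))

FinSet-ext : ∀ {X Y} → (∀ i → X ⟨ i ⟩ ≡ Y ⟨ i ⟩) → X ≡ Y
FinSet-ext {⟨ l , p ⟩} {⟨ m , q ⟩} e with refl ← normal-lookupD-injective l m p q e
  with refl ← Normal-irrelevant l p q = refl

△-identityʳ : ∀ X → X △ ∅ ≡ X
△-identityʳ X = FinSet-ext λ i → trans (△-⟨⟩ X ∅ i) (xor-identityʳ (X ⟨ i ⟩))

△-cancelˡ : ∀ X Y → X △ (X △ Y) ≡ Y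
△-cancelˡ X Y = FinSet-ext λ i → begin
  (X △ (X △ Y)) ⟨ i ⟩               ≡⟨ △-⟨⟩ X (X △ Y) i ⟩
  X ⟨ i ⟩ xor (X △ Y) ⟨ i ⟩         ≡⟨ cong (X ⟨ i ⟩ xor_) (△-⟨⟩ X Y i) ⟩
  X ⟨ i ⟩ xor (X ⟨ i ⟩ xor Y ⟨ i ⟩) ≡⟨ xor-cancelˡ (X ⟨ i ⟩) (Y ⟨ i ⟩) ⟩
  Y ⟨ i ⟩                           ∎

△-△-cancelˡ : ∀ X Y Z → (X △ Y) △ (X △ Z) ≡ Y △ Z
△-△-cancelˡ X Y Z = FinSet-ext λ i → begin
  ((X △ Y) △ (X △ Z)) ⟨ i ⟩                       ≡⟨ △-⟨⟩ (X △ Y) (X △ Z) i ⟩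
  (X △ Y) ⟨ i ⟩ xor (X △ Z) ⟨ i ⟩                 ≡⟨ cong₂ _xor_ (△-⟨⟩ X Y i) (△-⟨⟩ X Z i) ⟩
  (X ⟨ i ⟩ xor Y ⟨ i ⟩) xor (X ⟨ i ⟩ xor Z ⟨ i ⟩) ≡⟨ xor-xor-cancelˡ (X ⟨ i ⟩) (Y ⟨ i ⟩) (Z ⟨ i ⟩) ⟩
  Y ⟨ i ⟩ xor Z ⟨ i ⟩                             ≡⟨ △-⟨⟩ Y Z i ⟨
  (Y △ Z) ⟨ i ⟩                                   ∎

involution-preserving⇒⇔ : ∀ {a ℓ} {A : Set a} {f : A → A} (R : Rel A ℓ) →
                          (∀ x → f (f x) ≡ x) →
                          (∀ {x y} → R x y → R (f x) (f y)) →
                          ∀ x y → R x y ⇔ R (f x) (f y)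
involution-preserving⇒⇔ R f-involutive f-preserves x y =
  mk⇔ f-preserves (λ r → subst₂ R (f-involutive x) (f-involutive y) (f-preserves r))

h-involutive : ∀ X z → h X (h X z) ≡ z
h-involutive X (inj₁ Y)       = cong inj₁ (△-cancelˡ X Y)
h-involutive X (inj₂ (i , a)) = cong (λ b → inj₂ (i , b)) (xor-cancelʳ a (X ⟨ i ⟩))

h-bijective : ∀ X → Bijective _≡_ _≡_ (h X)
h-bijective X = inverseᵇ⇒bijective
  (strictlyInverseˡ⇒inverseˡ (h X) (h-involutive X) , strictlyInverseʳ⇒inverseʳ (h X) (h-involutive X))

h-preserves-E : ∀ X i {x y} → E i x y → E i (h X x) (h X y)
h-preserves-E X i {inj₁ Y} {inj₁ Z} Y△Z≡⟦i⟧ = trans (△-△-cancelˡ X Y Z) Y△Z≡⟦i⟧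

h-preserves-D : ∀ X i {x y} → D i x y → D i (h X x) (h X y)
h-preserves-D X i {inj₁ Y} {inj₂ (.i , a)} (refl , Yi≡a) = refl , (begin
  (X △ Y) ⟨ i ⟩          ≡⟨ △-⟨⟩ X Y i ⟩
  X ⟨ i ⟩ xor Y ⟨ i ⟩    ≡⟨ xor-comm (X ⟨ i ⟩) (Y ⟨ i ⟩) ⟩
  Y ⟨ i ⟩ xor X ⟨ i ⟩    ≡⟨ cong (_xor X ⟨ i ⟩) Yi≡a ⟩
  a xor X ⟨ i ⟩          ∎)

h-isAutomorphism : ∀ X → IsAutomorphism (h X)
h-isAutomorphism X =
    h-bijective X
  , (λ i → involution-preserving⇒⇔ (E i) (h-involutive X) (h-preserves-E X i))
  , (λ i → involution-preserving⇒⇔ (D i) (h-involutive X) (h-preserves-D X i))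

h-∅ : ∀ X → h X (inj₁ ∅) ≡ inj₁ X
h-∅ X = cong inj₁ (△-identityʳ X)

D-source : ∀ {i x y} → D i x y → ∃ λ W → x ≡ inj₁ W
D-source {x = inj₁ W} {inj₂ _} _ = W , refl

D-target : ∀ {i W y} → D i (inj₁ W) y → y ≡ inj₂ (i , W ⟨ i ⟩)
D-target {y = inj₂ (_ , _)} (refl , refl) = refl

module _ {g : H → H} (g-aut : IsAutomorphism g) where

  private
    g-injective : ∀ {x y} → g x ≡ g y → x ≡ y
    g-injective = proj₁ (proj₁ g-aut)

    g-preserves-D : ∀ {i x y} → D i x y → D i (g x) (g y)
    g-preserves-D {i} {x} {y} = Equivalence.to (proj₂ (proj₂ g-aut) i x y)

  automorphism-FinSet : ∀ Y → ∃ λ Y′ → g (inj₁ Y) ≡ inj₁ Y′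
  automorphism-FinSet Y = D-source (g-preserves-D {zero} {y = inj₂ (zero , Y ⟨ zero ⟩)} (refl , refl))

  automorphism-D : ∀ i {W W′} → g (inj₁ W) ≡ inj₁ W′ →
                   g (inj₂ (i , W ⟨ i ⟩)) ≡ inj₂ (i , W′ ⟨ i ⟩)
  automorphism-D i {W} gW≡W′ =
    D-target (subst (λ x → D i x (g (inj₂ (i , W ⟨ i ⟩)))) gW≡W′ (g-preserves-D (refl , refl)))

  module _ {X : FinSet} (g∅≡X : g (inj₁ ∅) ≡ inj₁ X) where

    automorphism-point : ∀ i a → g (inj₂ (i , a)) ≡ inj₂ (i , a xor X ⟨ i ⟩)
    automorphism-point i false = automorphism-D i g∅≡X
    automorphism-point i true
      with Y′ , g⟦i⟧≡Y′ ← automorphism-FinSet ⟦ i ⟧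
      with g1≡Y′i ← subst (λ a → g (inj₂ (i , a)) ≡ inj₂ (i , Y′ ⟨ i ⟩)) (⟦⟧-⟨⟩ i) (automorphism-D i g⟦i⟧≡Y′)
      = trans g1≡Y′i (cong (λ c → inj₂ (i , c)) (¬-not Y′i≢Xi))
      where
      Y′i≢Xi : Y′ ⟨ i ⟩ ≡ X ⟨ i ⟩ → ⊥
      Y′i≢Xi Y′i≡Xi with () ← g-injective (begin
        g (inj₂ (i , true))      ≡⟨ g1≡Y′i ⟩
        inj₂ (i , Y′ ⟨ i ⟩)      ≡⟨ cong (λ c → inj₂ (i , c)) Y′i≡Xi ⟩
        inj₂ (i , X ⟨ i ⟩)       ≡⟨ automorphism-point i false ⟨
        g (inj₂ (i , false))     ∎)

    automorphism-unique : ∀ z → g z ≡ h X z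
    automorphism-unique (inj₂ (i , a)) = automorphism-point i a
    automorphism-unique (inj₁ Y) with Y′ , gY≡Y′ ← automorphism-FinSet Y =
      trans gY≡Y′ (cong inj₁ (FinSet-ext λ i → cong proj₂ (inj₂-injective (begin
        inj₂ (i , Y′ ⟨ i ⟩)               ≡⟨ automorphism-D i gY≡Y′ ⟨
        g (inj₂ (i , Y ⟨ i ⟩))            ≡⟨ automorphism-point i (Y ⟨ i ⟩) ⟩
        inj₂ (i , Y ⟨ i ⟩ xor X ⟨ i ⟩)    ≡⟨ cong (λ c → inj₂ (i , c)) (xor-comm (Y ⟨ i ⟩) (X ⟨ i ⟩)) ⟩
        inj₂ (i , X ⟨ i ⟩ xor Y ⟨ i ⟩)    ≡⟨ cong (λ c → inj₂ (i , c)) (△-⟨⟩ X Y i) ⟨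
        inj₂ (i , (X △ Y) ⟨ i ⟩)          ∎))))

proposition3p7 : (X : FinSet) →
    (IsAutomorphism (h X) × h X (inj₁ ∅) ≡ inj₁ X)
    × (∀ (g : H → H) → IsAutomorphism g → g (inj₁ ∅) ≡ inj₁ X → ∀ z → g z ≡ h X z)
proposition3p7 X = (h-isAutomorphism X , h-∅ X) , λ g g-aut → automorphism-unique g-aut
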